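{- Let $s=f(s_1,\ldots,s_n)$ and $t=f(t_1,\ldots,t_n)$ be terms (or atoms), and let $k>1$ be an integer greater than the arity of every function symbol occurring in $s$ and $t$. Then $\|s\doteq t\|>\sum_{i=1}^n \|s_i\doteq t_i\|$.
   Context: For a term $t$, $|t|$ denotes the number of occurrences in $t$ of variables and function symbols (including constants). For terms $t,u$, $\|t\doteq u\| = k^{\max(|t|,|u|)}$ where $k$ is the fixed integer from the statement. -}

module Defs where

open import Data.Nat using (ℕ; suc; zero; _+_; _^_; _⊔_; _<_)
open import Data.Vec using (Vec; []; _∷_)
open import Data.Fin using (Fin)
open import Data.Unit using (⊤)
open import Data.Product using (_×_)

-- Constants are function symbols of arity 0.  Atoms P(t1,...,tn) are
-- represented the same way (predicate symbol as head symbol).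
data Term : Set where
  var : ℕ → Term
  fun : (f : ℕ) (n : ℕ) → Vec Term n → Term

mutual
  size : Term → ℕ
  size (var x)      = 1
  size (fun f n ts) = suc (sizes ts)

  sizes : ∀ {n} → Vec Term n → ℕ
  sizes []       = 0
  sizes (t ∷ ts) = size t + sizes ts

mutual
  AritiesBelow : ℕ → Term → Set
  AritiesBelow k (var x)      = ⊤
  AritiesBelow k (fun f n ts) = (n < k) × AllAritiesBelow k ts

  AllAritiesBelow : ∀ {n} → ℕ → Vec Term n → Set
  AllAritiesBelow k []       = ⊤
  AllAritiesBelow k (t ∷ ts) = AritiesBelow k t × AllAritiesBelow k ts

‖_≐_‖[_] : Term → Term → ℕ → ℕ
‖ t ≐ u ‖[ k ] = k ^ (size t ⊔ size u)

Σ[_<_] : (n : ℕ) → (Fin n → ℕ) → ℕ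
Σ[ zero < f ] = 0
Σ[ suc n < f ] = f Fin.zero + Σ[ n < (λ i → f (Fin.suc i)) ]

{-# OPTIONS --safe #-}
-- Each of the n summands is at most k ^ m, where m bounds the total size of
-- both argument lists; the head symbol then contributes the one extra factor
-- k > n.
module Submission where

open import Defs
open import Data.Nat using (ℕ; _<_; _≤_; _*_; _^_; _⊔_; z≤n; s≤s; NonZero; >-nonZero)
open import Data.Nat.Properties
open import Data.Vec using (Vec; lookup; []; _∷_)
open import Data.Product using (_,_)

‖≐‖-mono : ∀ (k : ℕ) .{{_ : NonZero k}} {m} (s t : Term) →
  size s ≤ m → size t ≤ m → ‖ s ≐ t ‖[ k ] ≤ k ^ m
‖≐‖-mono k s t |s|≤m |t|≤m = ^-monoʳ-≤ k (⊔-lub |s|≤m |t|≤m)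

Σ‖≐‖≤n*k^m : ∀ (k : ℕ) .{{_ : NonZero k}} {m n} (ss ts : Vec Term n) →
  sizes ss ≤ m → sizes ts ≤ m →
  Σ[ n < (λ i → ‖ lookup ss i ≐ lookup ts i ‖[ k ]) ] ≤ n * k ^ m
Σ‖≐‖≤n*k^m k []       []       _ _ = z≤n
Σ‖≐‖≤n*k^m k (s ∷ ss) (t ∷ ts) p q =
  +-mono-≤ (‖≐‖-mono k s t (m+n≤o⇒m≤o (size s) p) (m+n≤o⇒m≤o (size t) q))
           (Σ‖≐‖≤n*k^m k ss ts (m+n≤o⇒n≤o (size s) p) (m+n≤o⇒n≤o (size t) q))

lemma6 : (k f n : ℕ) (ss ts : Vec Term n) →
    1 < k →
    AritiesBelow k (fun f n ss) →
    AritiesBelow k (fun f n ts) →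
    Σ[ n < (λ i → ‖ lookup ss i ≐ lookup ts i ‖[ k ]) ] < ‖ fun f n ss ≐ fun f n ts ‖[ k ]
lemma6 k f n ss ts 1<k (n<k , _) _ = begin-strict
  Σ[ n < (λ i → ‖ lookup ss i ≐ lookup ts i ‖[ k ]) ]
    ≤⟨ Σ‖≐‖≤n*k^m k ss ts (m≤m⊔n (sizes ss) (sizes ts)) (m≤n⊔m (sizes ss) (sizes ts)) ⟩
  n * k ^ m
    <⟨ *-monoˡ-< (k ^ m) n<k ⟩
  k * k ^ m
    ≡⟨⟩
  ‖ fun f n ss ≐ fun f n ts ‖[ k ] ∎
  where
  open ≤-Reasoning
  m : ℕ
  m = sizes ss ⊔ sizes ts
  instance
    k≢0 : NonZero k
    k≢0 = >-nonZero (<-trans (s≤s z≤n) 1<k)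
    k^m≢0 : NonZero (k ^ m)
    k^m≢0 = >-nonZero (m^n>0 k m)
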